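{- Let $\mathcal{L}$ be a unimodal signature. The class of bi-Heyting $\mathcal{L}$-unimodal algebras is a variety. The class of Heyting $\mathcal{L}$-unimodal algebras is a variety if $\mathcal{L}=\{\Box_{ - },\Box_{+}\}$, or $\mathcal{L}=\{\Diamond_{ - },\Diamond_{+}\}$, or $\mathcal{L}$ contains only one modal symbol.
   Context: All distributive lattices are bounded. A Heyting algebra is a bounded distributive lattice with a binary operation $\rightarrow$ such that $a\wedge b\leq c \iff b\leq a\rightarrow c$; a co-Heyting algebra is a bounded distributive lattice with a binary operation $-$ such that $a\leq b\vee c\iff a-b\leq c$; a bi-Heyting algebra has both. The modal symbols are $\Box_{+},\Box_{ - },\Diamond_{+},\Diamond_{ - }$; a unimodal signature $\mathcal{L}$ is a subset of $\{\Box_{+},\Box_{ - },\Diamond_{+},\Diamond_{ - }\}$. An $\mathcal{L}$-modal algebra is a bounded distributive lattice with one unary operation for each symbol in $\mathcal{L}$, satisfying the applicable identities $\Box_{+}(a\wedge b)=\Box_{+}a\wedge\Box_{+}b$, $\Box_{+}\top=\top$; $\Box_{ - }(a\vee b)=\Box_{ - }a\wedge\Box_{ - }b$, $\Box_{ - }\bot=\top$; $\Diamond_{+}(a\vee b)=\Diamond_{+}a\vee\Diamond_{+}b$, $\Diamond_{+}\bot=\bot$; $\Diamond_{ - }(a\wedge b)=\Diamond_{ - }a\vee\Diamond_{ - }b$, $\Diamond_{ - }\top=\bot$. An $\mathcal{L}$-unimodal algebra is an $\mathcal{L}$-modal algebra which satisfies, for all elements $a,b,c$, each of the following conditions whose two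 labelling symbols both belong to $\mathcal{L}$: $(\Box_{+},\Box_{ - })$: $\Box_{ - }a\wedge\Box_{+}(a\vee b)\leq\Box_{+}b$; $(\Box_{ - },\Box_{+})$: $\Box_{+}a\wedge\Box_{ - }(a\wedge b)\leq\Box_{ - }b$; $(\Diamond_{+},\Diamond_{ - })$: $\Diamond_{+}b\leq\Diamond_{+}(a\wedge b)\vee\Diamond_{ - }a$; $(\Diamond_{ - },\Diamond_{+})$: $\Diamond_{ - }b\leq\Diamond_{ - }(a\vee b)\vee\Diamond_{+}a$; $(\Box_{+},\Diamond_{ - })$: if $\Diamond_{ - }a\wedge c\leq\Box_{+}a$ then $c\leq\Box_{+}a$; $(\Box_{ - },\Diamond_{+})$: if $\Diamond_{+}a\wedge c\leq\Box_{ - }a$ then $c\leq\Box_{ - }a$; $(\Diamond_{+},\Box_{ - })$: if $\Diamond_{+}a\leq\Box_{ - }a\vee c$ then $\Diamond_{+}a\leq c$; $(\Diamond_{ - },\Box_{+})$: if $\Diamond_{ - }a\leq\Box_{+}a\vee c$ then $\Diamond_{ - }a\leq c$; $(\Box_{+},\Diamond_{+})$: if $\Diamond_{+}b\wedge c\leq\Box_{+}a$ then $\Box_{+}(a\vee b)\wedge c\leq\Box_{+}a$; $(\Box_{ - },\Diamond_{ - })$: if $\Diamond_{ - }b\wedge c\leq\Box_{ - }a$ then $\Box_{ - }(a\wedge b)\wedge c\leq\Box_{ - }a$; $(\Diamond_{+},\Box_{+})$: if $\Diamond_{+}a\leq\Box_{+}b\vee c$ then $\Diamond_{+}a\leq\Diamond_{+}(a\wedge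 b)\vee c$; $(\Diamond_{ - },\Box_{ - })$: if $\Diamond_{ - }a\leq\Box_{ - }b\vee c$ then $\Diamond_{ - }a\leq\Diamond_{ - }(a\vee b)\vee c$. A (bi-)Heyting $\mathcal{L}$-unimodal algebra is an algebra which is both a (bi-)Heyting algebra and an $\mathcal{L}$-unimodal algebra over the same lattice, i.e. an $\mathcal{L}$-unimodal algebra expanded by $\rightarrow$ (and $-$). -}

module Defs where

open import Data.Bool using (Bool; true; false; T)
open import Data.Nat using (ℕ)
open import Data.Unit using (⊤)
open import Data.Product using (Σ; _×_; _,_)
open import Function.Bundles using (_⇔_)
open import Relation.Binary.PropositionalEquality using (_≡_)
import Algebra.Lattice.Structures as LS

data Sym : Set where
  □₊ □₋ ◇₊ ◇₋ : Sym

Signature : Set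
Signature = Sym → Bool

-- The flag `bi` says whether the co-implication − is in the signature
-- (bi = true : bi-Heyting signature, bi = false : Heyting signature).

record RawAlg (bi : Bool) (L : Signature) : Set₁ where
  field
    Carrier : Set
    top bot : Carrier
    _∧_ _∨_ _⇒_ : Carrier → Carrier → Carrier
    sub : T bi → Carrier → Carrier → Carrier
    op  : (m : Sym) → T (L m) → Carrier → Carrier

  _≤_ : Carrier → Carrier → Set
  a ≤ b = (a ∧ b) ≡ a

  infixr 7 _∧_
  infixr 6 _∨_

data Term (bi : Bool) (L : Signature) : Set where
  var  : ℕ → Term bi L
  `top `bot : Term bi L
  meet join imp : Term bi L → Term bi L → Term bi L
  `sub : T bi → Term bi L → Term bi L → Term bi L
  `op  : (m : Sym) → T (L m) → Term bi L → Term bi L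

module _ {bi : Bool} {L : Signature} (A : RawAlg bi L) where
  open RawAlg A

  eval : (ℕ → Carrier) → Term bi L → Carrier
  eval ρ (var n)      = ρ n
  eval ρ `top         = RawAlg.top A
  eval ρ `bot         = RawAlg.bot A
  eval ρ (meet s t)   = eval ρ s ∧ eval ρ t
  eval ρ (join s t)   = eval ρ s ∨ eval ρ t
  eval ρ (imp s t)    = eval ρ s ⇒ eval ρ t
  eval ρ (`sub p s t)  = RawAlg.sub A p (eval ρ s) (eval ρ t)
  eval ρ (`op m p t)   = RawAlg.op A m p (eval ρ t)

  Satisfies : Term bi L → Term bi L → Set
  Satisfies s t = (ρ : ℕ → Carrier) → eval ρ s ≡ eval ρ t

IsVariety : {bi : Bool} {L : Signature} → (RawAlg bi L → Set) → Set₁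
IsVariety {bi} {L} K =
  Σ (Term bi L → Term bi L → Set) λ E →
    (A : RawAlg bi L) →
      K A ⇔ ((s t : Term bi L) → E s t → Satisfies A s t)

module _ {bi : Bool} {L : Signature} (A : RawAlg bi L) where
  open RawAlg A

  record IsBDL : Set where
    field
      isDistributiveLattice : LS.IsDistributiveLattice {A = Carrier} _≡_ _∨_ _∧_
      top-max : (a : Carrier) → a ≤ top
      bot-min : (a : Carrier) → bot ≤ a

  IsHeytingImp : Set
  IsHeytingImp = (a b c : Carrier) → ((a ∧ b) ≤ c) ⇔ (b ≤ (a ⇒ c))

  IsCoHeytingSub : T bi → Set
  IsCoHeytingSub p = (a b c : Carrier) → (a ≤ (b ∨ c)) ⇔ (sub p a b ≤ c)

  ModalLaws : (m : Sym) → (Carrier → Carrier) → Set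
  ModalLaws □₊ f = ((a b : Carrier) → f (a ∧ b) ≡ f a ∧ f b) × f top ≡ top
  ModalLaws □₋ f = ((a b : Carrier) → f (a ∨ b) ≡ f a ∧ f b) × f bot ≡ top
  ModalLaws ◇₊ f = ((a b : Carrier) → f (a ∨ b) ≡ f a ∨ f b) × f bot ≡ bot
  ModalLaws ◇₋ f = ((a b : Carrier) → f (a ∧ b) ≡ f a ∨ f b) × f top ≡ bot

  Cond : (s t : Sym) → (f g : Carrier → Carrier) → Set
  Cond □₊ □₋ B₊ B₋ = (a b : Carrier) → (B₋ a ∧ B₊ (a ∨ b)) ≤ B₊ b
  Cond □₋ □₊ B₋ B₊ = (a b : Carrier) → (B₊ a ∧ B₋ (a ∧ b)) ≤ B₋ b
  Cond ◇₊ ◇₋ D₊ D₋ = (a b : Carrier) → D₊ b ≤ (D₊ (a ∧ b) ∨ D₋ a)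
  Cond ◇₋ ◇₊ D₋ D₊ = (a b : Carrier) → D₋ b ≤ (D₋ (a ∨ b) ∨ D₊ a)
  Cond □₊ ◇₋ B₊ D₋ = (a c : Carrier) → (D₋ a ∧ c) ≤ B₊ a → c ≤ B₊ a
  Cond □₋ ◇₊ B₋ D₊ = (a c : Carrier) → (D₊ a ∧ c) ≤ B₋ a → c ≤ B₋ a
  Cond ◇₊ □₋ D₊ B₋ = (a c : Carrier) → D₊ a ≤ (B₋ a ∨ c) → D₊ a ≤ c
  Cond ◇₋ □₊ D₋ B₊ = (a c : Carrier) → D₋ a ≤ (B₊ a ∨ c) → D₋ a ≤ c
  Cond □₊ ◇₊ B₊ D₊ = (a b c : Carrier) →
    (D₊ b ∧ c) ≤ B₊ a → (B₊ (a ∨ b) ∧ c) ≤ B₊ a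
  Cond □₋ ◇₋ B₋ D₋ = (a b c : Carrier) →
    (D₋ b ∧ c) ≤ B₋ a → (B₋ (a ∧ b) ∧ c) ≤ B₋ a
  Cond ◇₊ □₊ D₊ B₊ = (a b c : Carrier) →
    D₊ a ≤ (B₊ b ∨ c) → D₊ a ≤ (D₊ (a ∧ b) ∨ c)
  Cond ◇₋ □₋ D₋ B₋ = (a b c : Carrier) →
    D₋ a ≤ (B₋ b ∨ c) → D₋ a ≤ (D₋ (a ∨ b) ∨ c)
  Cond □₊ □₊ _ _ = ⊤
  Cond □₋ □₋ _ _ = ⊤
  Cond ◇₊ ◇₊ _ _ = ⊤
  Cond ◇₋ ◇₋ _ _ = ⊤

  record IsUnimodal : Set where
    field
      isBDL     : IsBDL
      modalLaws : (m : Sym) (p : T (L m)) → ModalLaws m (op m p)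
      unimodal  : (s t : Sym) (p : T (L s)) (q : T (L t)) →
                  Cond s t (op s p) (op t q)

IsHeytingUnimodal : (L : Signature) → RawAlg false L → Set
IsHeytingUnimodal L A = IsUnimodal A × IsHeytingImp A

IsBiHeytingUnimodal : (L : Signature) → RawAlg true L → Set
IsBiHeytingUnimodal L A =
  IsUnimodal A × IsHeytingImp A × IsCoHeytingSub A _

IsBoxPair : Signature → Set
IsBoxPair L = L □₊ ≡ true × L □₋ ≡ true × L ◇₊ ≡ false × L ◇₋ ≡ false

IsDiamondPair : Signature → Set
IsDiamondPair L = L □₊ ≡ false × L □₋ ≡ false × L ◇₊ ≡ true × L ◇₋ ≡ true

IsSingleton : Signature → Set
IsSingleton L = Σ Sym λ s → L s ≡ true × ((t : Sym) → L t ≡ true → t ≡ s)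

-- Every unimodality condition is an inequation or a quasi-identity in a fresh variable c of
-- the form "if α ∧ c ≤ β then γ ∧ c ≤ β" (box–diamond) or "if α ≤ β ∨ c then α ≤ γ ∨ c"
-- (diamond–box), with γ possibly absent. By residuation these are equivalent to the
-- inequations γ ∧ (α → β) ≤ β and α ≤ γ ∨ (α − β). So the conditions become identities as
-- soon as − is available for the diamond–box pairs: always in a bi-Heyting algebra, and in a
-- Heyting algebra whenever L contains no diamond together with a box, which is the case for
-- the three kinds of signatures in the theorem. Adding the standard equational bases of
-- bounded distributive lattices, Heyting and co-Heyting algebras and the modal laws gives
-- an equational basis of the class.
module Submission where

open import Defs
open import Data.Bool using (Bool; true; false; T; not)
import Data.Bool as Bool
open import Data.Bool.Properties using (∨-zeroʳ; ∧-zeroʳ; ∧-inverseʳ; T-≡)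
open import Data.Empty using (⊥-elim)
open import Data.Nat using (ℕ; zero; suc)
open import Data.Product using (_×_; _,_; proj₁; proj₂)
open import Data.Sum using (_⊎_; inj₁; inj₂)
open import Data.Unit using (tt)
open import Function.Bundles using (_⇔_; mk⇔; Equivalence)
open import Function.Properties.Equivalence using () renaming (sym to ⇔-sym; trans to ⇔-trans)
open import Level using (0ℓ)
open import Relation.Binary.PropositionalEquality
  using (_≡_; refl; sym; trans; cong; cong₂; subst)
open import Algebra.Lattice.Bundles using (Lattice)
import Algebra.Lattice.Properties.Lattice as LatticeProperties
import Algebra.Lattice.Structures as LS
import Relation.Binary.Lattice as R
import Relation.Binary.Lattice.Properties.JoinSemilattice as JoinProperties
import Relation.Binary.Lattice.Properties.MeetSemilattice as MeetProperties

open Equivalence using (to; from)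

module LatticeOrder {bi : Bool} {L : Signature} (A : RawAlg bi L) (bdl : IsBDL A) where
  open RawAlg A

  private
    lattice : Lattice 0ℓ 0ℓ
    lattice = record
      { isLattice = LS.IsDistributiveLattice.isLattice (IsBDL.isDistributiveLattice bdl) }

    -- The library orders a lattice by a ≡ a ∧ b; our a ≤ b is its symmetric form.
    module O = R.Lattice (LatticeProperties.∨-∧-orderTheoreticLattice lattice)
    module J = JoinProperties O.joinSemilattice
    module M = MeetProperties O.meetSemilattice

  ≤-refl : ∀ {a} → a ≤ a
  ≤-refl = sym O.refl

  ≤-reflexive : ∀ {a b} → a ≡ b → a ≤ b
  ≤-reflexive e = sym (O.reflexive e)

  ≤-trans : ∀ {a b c} → a ≤ b → b ≤ c → a ≤ c
  ≤-trans p q = sym (O.trans (sym p) (sym q))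

  ≤-antisym : ∀ {a b} → a ≤ b → b ≤ a → a ≡ b
  ≤-antisym p q = O.antisym (sym p) (sym q)

  x∧y≤x : ∀ {a b} → (a ∧ b) ≤ a
  x∧y≤x = sym (O.x∧y≤x _ _)

  x∧y≤y : ∀ {a b} → (a ∧ b) ≤ b
  x∧y≤y = sym (O.x∧y≤y _ _)

  ∧-greatest : ∀ {a b c} → a ≤ b → a ≤ c → a ≤ (b ∧ c)
  ∧-greatest p q = sym (O.∧-greatest (sym p) (sym q))

  x≤x∨y : ∀ {a b} → a ≤ (a ∨ b)
  x≤x∨y = sym (O.x≤x∨y _ _)

  y≤x∨y : ∀ {a b} → b ≤ (a ∨ b)
  y≤x∨y = sym (O.y≤x∨y _ _)

  ∨-least : ∀ {a b c} → a ≤ c → b ≤ c → (a ∨ b) ≤ c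
  ∨-least p q = sym (O.∨-least (sym p) (sym q))

  ∧-monoʳ-≤ : ∀ {a b c} → b ≤ c → (a ∧ b) ≤ (a ∧ c)
  ∧-monoʳ-≤ p = sym (M.∧-monotonic O.refl (sym p))

  ∨-monoʳ-≤ : ∀ {a b c} → b ≤ c → (a ∨ b) ≤ (a ∨ c)
  ∨-monoʳ-≤ p = sym (J.∨-monotonic O.refl (sym p))

  x≤y⇒x∨y≡y : ∀ {a b} → a ≤ b → a ∨ b ≡ b
  x≤y⇒x∨y≡y p = J.x≤y⇒x∨y≈y (sym p)

module HeytingProperties {bi : Bool} {L : Signature} (A : RawAlg bi L) (bdl : IsBDL A)
                         (heyting : IsHeytingImp A) where
  open RawAlg A
  open LatticeOrder A bdl

  ⇒-intro : ∀ {a b c} → (a ∧ b) ≤ c → b ≤ (a ⇒ c)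
  ⇒-intro = to (heyting _ _ _)

  ⇒-elim : ∀ {a c} → (a ∧ (a ⇒ c)) ≤ c
  ⇒-elim = from (heyting _ _ _) ≤-refl

  ⇒-unit : ∀ {a b} → b ≤ (a ⇒ (a ∧ b))
  ⇒-unit = ⇒-intro ≤-refl

  ⇒-distribˡ-∧ : ∀ {a b c} → (a ⇒ (b ∧ c)) ≡ ((a ⇒ b) ∧ (a ⇒ c))
  ⇒-distribˡ-∧ = ≤-antisym
    (∧-greatest (⇒-intro (≤-trans ⇒-elim x∧y≤x)) (⇒-intro (≤-trans ⇒-elim x∧y≤y)))
    (⇒-intro (∧-greatest (≤-trans (∧-monoʳ-≤ x∧y≤x) ⇒-elim)
                         (≤-trans (∧-monoʳ-≤ x∧y≤y) ⇒-elim)))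

  quasiIdentity⇔⇒-inequation : ∀ {α β} →
    ((c : Carrier) → (α ∧ c) ≤ β → c ≤ β) ⇔ ((α ⇒ β) ≤ β)
  quasiIdentity⇔⇒-inequation = mk⇔ (λ h → h _ ⇒-elim) (λ h c k → ≤-trans (⇒-intro k) h)

  quasiIdentity⇔∧⇒-inequation : ∀ {α β γ} →
    ((c : Carrier) → (α ∧ c) ≤ β → (γ ∧ c) ≤ β) ⇔ ((γ ∧ (α ⇒ β)) ≤ β)
  quasiIdentity⇔∧⇒-inequation =
    mk⇔ (λ h → h _ ⇒-elim) (λ h c k → ≤-trans (∧-monoʳ-≤ (⇒-intro k)) h)

module CoHeytingProperties {bi : Bool} {L : Signature} (A : RawAlg bi L) (bdl : IsBDL A)
                           (p : T bi) (coHeyting : IsCoHeytingSub A p) where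
  open RawAlg A
  open LatticeOrder A bdl

  _−_ : Carrier → Carrier → Carrier
  _−_ = sub p

  −-elim : ∀ {a b c} → a ≤ (b ∨ c) → (a − b) ≤ c
  −-elim = to (coHeyting _ _ _)

  −-unit : ∀ {a b} → a ≤ (b ∨ (a − b))
  −-unit = from (coHeyting _ _ _) ≤-refl

  −-counit : ∀ {a b} → ((a ∨ b) − a) ≤ b
  −-counit = −-elim ≤-refl

  −-distribʳ-∨ : ∀ {a b c} → ((a ∨ b) − c) ≡ ((a − c) ∨ (b − c))
  −-distribʳ-∨ = ≤-antisym
    (−-elim (∨-least (≤-trans −-unit (∨-monoʳ-≤ x≤x∨y)) (≤-trans −-unit (∨-monoʳ-≤ y≤x∨y))))
    (∨-least (−-elim (≤-trans x≤x∨y −-unit)) (−-elim (≤-trans y≤x∨y −-unit)))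

  quasiIdentity⇔−-inequation : ∀ {α β} →
    ((c : Carrier) → α ≤ (β ∨ c) → α ≤ c) ⇔ (α ≤ (α − β))
  quasiIdentity⇔−-inequation = mk⇔ (λ h → h _ −-unit) (λ h c k → ≤-trans h (−-elim k))

  quasiIdentity⇔∨−-inequation : ∀ {α β γ} →
    ((c : Carrier) → α ≤ (β ∨ c) → α ≤ (γ ∨ c)) ⇔ (α ≤ (γ ∨ (α − β)))
  quasiIdentity⇔∨−-inequation =
    mk⇔ (λ h → h _ −-unit) (λ h c k → ≤-trans h (∨-monoʳ-≤ (−-elim k)))

isDiamond : Sym → Bool
isDiamond □₊ = false
isDiamond □₋ = false
isDiamond ◇₊ = true
isDiamond ◇₋ = true

isDiamondBox : Sym → Sym → Bool
isDiamondBox s t = isDiamond s Bool.∧ not (isDiamond t)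

-- The condition (s, t) can be written as an identity in the signature with flag bi.
Equational : Bool → Sym → Sym → Set
Equational bi s t = T (not (isDiamondBox s t) Bool.∨ bi)

equational-bi : ∀ s t → Equational true s t
equational-bi s t = subst T (sym (∨-zeroʳ (not (isDiamondBox s t)))) tt

equational-¬diamondBox : ∀ {bi} s t → isDiamondBox s t ≡ false → Equational bi s t
equational-¬diamondBox s t e rewrite e = tt

record Inequation (bi : Bool) (L : Signature) : Set where
  constructor _≼_
  field
    lhs rhs : Term bi L

infix 4 _≼_

_⊨_ : {bi : Bool} {L : Signature} → RawAlg bi L → Inequation bi L → Set
A ⊨ (u ≼ v) = Satisfies A (meet u v) u

module _ {bi : Bool} {L : Signature} where
  x y z : Term bi L
  x = var 0
  y = var 1
  z = var 2

  unimodalityInequation : (s t : Sym) (f g : Term bi L → Term bi L) →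
                          Equational bi s t → Inequation bi L
  unimodalityInequation □₊ □₋ f g _ = meet (g x) (f (join x y)) ≼ f y
  unimodalityInequation □₋ □₊ f g _ = meet (g x) (f (meet x y)) ≼ f y
  unimodalityInequation ◇₊ ◇₋ f g _ = f y ≼ join (f (meet x y)) (g x)
  unimodalityInequation ◇₋ ◇₊ f g _ = f y ≼ join (f (join x y)) (g x)
  unimodalityInequation □₊ ◇₋ f g _ = imp (g x) (f x) ≼ f x
  unimodalityInequation □₋ ◇₊ f g _ = imp (g x) (f x) ≼ f x
  unimodalityInequation ◇₊ □₋ f g r = f x ≼ `sub r (f x) (g x)
  unimodalityInequation ◇₋ □₊ f g r = f x ≼ `sub r (f x) (g x)
  unimodalityInequation □₊ ◇₊ f g _ = meet (f (join x y)) (imp (g y) (f x)) ≼ f x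
  unimodalityInequation □₋ ◇₋ f g _ = meet (f (meet x y)) (imp (g y) (f x)) ≼ f x
  unimodalityInequation ◇₊ □₊ f g r = f x ≼ join (f (meet x y)) (`sub r (f x) (g y))
  unimodalityInequation ◇₋ □₋ f g r = f x ≼ join (f (join x y)) (`sub r (f x) (g y))
  unimodalityInequation □₊ □₊ f g _ = `top ≼ `top
  unimodalityInequation □₋ □₋ f g _ = `top ≼ `top
  unimodalityInequation ◇₊ ◇₊ f g _ = `top ≼ `top
  unimodalityInequation ◇₋ ◇₋ f g _ = `top ≼ `top

-- The inequational axioms u ≤ v are stated as u ∧ v ≈ u.
data Axiom {bi : Bool} {L : Signature} : Term bi L → Term bi L → Set where
  join-comm          : Axiom (join x y) (join y x)
  join-assoc         : Axiom (join (join x y) z) (join x (join y z))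
  meet-comm          : Axiom (meet x y) (meet y x)
  meet-assoc         : Axiom (meet (meet x y) z) (meet x (meet y z))
  join-absorbs-meet  : Axiom (join x (meet x y)) x
  meet-absorbs-join  : Axiom (meet x (join x y)) x
  join-distribˡ-meet : Axiom (join x (meet y z)) (meet (join x y) (join x z))
  join-distribʳ-meet : Axiom (join (meet y z) x) (meet (join y x) (join z x))
  meet-distribˡ-join : Axiom (meet x (join y z)) (join (meet x y) (meet x z))
  meet-distribʳ-join : Axiom (meet (join y z) x) (join (meet y x) (meet z x))
  top-greatest       : Axiom (meet x `top) x
  bot-least          : Axiom (meet `bot x) `bot
  imp-elim           : Axiom (meet (meet x (imp x y)) y) (meet x (imp x y))
  imp-unit           : Axiom (meet y (imp x (meet x y))) y
  imp-distribˡ-meet  : Axiom (imp x (meet y z)) (meet (imp x y) (imp x z))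
  sub-unit           : (p : T bi) → Axiom (meet x (join y (`sub p x y))) x
  sub-counit         : (p : T bi) → Axiom (meet (`sub p (join x y) x) y) (`sub p (join x y) x)
  sub-distribʳ-join  : (p : T bi) →
                       Axiom (`sub p (join x y) z) (join (`sub p x z) (`sub p y z))
  □₊-meet : (p : T (L □₊)) → Axiom (`op □₊ p (meet x y)) (meet (`op □₊ p x) (`op □₊ p y))
  □₊-top  : (p : T (L □₊)) → Axiom (`op □₊ p `top) `top
  □₋-join : (p : T (L □₋)) → Axiom (`op □₋ p (join x y)) (meet (`op □₋ p x) (`op □₋ p y))
  □₋-bot  : (p : T (L □₋)) → Axiom (`op □₋ p `bot) `top
  ◇₊-join : (p : T (L ◇₊)) → Axiom (`op ◇₊ p (join x y)) (join (`op ◇₊ p x) (`op ◇₊ p y))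
  ◇₊-bot  : (p : T (L ◇₊)) → Axiom (`op ◇₊ p `bot) `bot
  ◇₋-meet : (p : T (L ◇₋)) → Axiom (`op ◇₋ p (meet x y)) (join (`op ◇₋ p x) (`op ◇₋ p y))
  ◇₋-top  : (p : T (L ◇₋)) → Axiom (`op ◇₋ p `top) `bot
  unimodality : (s t : Sym) (p : T (L s)) (q : T (L t)) (r : Equational bi s t) →
                let u ≼ v = unimodalityInequation s t (`op s p) (`op t q) r
                in Axiom (meet u v) u

HeytingUnimodal : (bi : Bool) (L : Signature) → RawAlg bi L → Set
HeytingUnimodal bi L A = IsUnimodal A × IsHeytingImp A × ((p : T bi) → IsCoHeytingSub A p)

valuation : {C : Set} → C → C → C → ℕ → C
valuation a b c zero          = a
valuation a b c (suc zero)    = b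
valuation a b c (suc (suc _)) = c

module _ {bi : Bool} {L : Signature} (A : RawAlg bi L) (bdl : IsBDL A)
         (heyting : IsHeytingImp A) (coHeyting : (p : T bi) → IsCoHeytingSub A p) where
  open RawAlg A
  open LatticeOrder A bdl using (≤-refl)
  open HeytingProperties A bdl heyting
  open CoHeytingProperties A bdl using (quasiIdentity⇔−-inequation; quasiIdentity⇔∨−-inequation)

  cond⇔unimodalityInequation : (s t : Sym) (p : T (L s)) (q : T (L t)) (r : Equational bi s t) →
    Cond A s t (op s p) (op t q) ⇔ A ⊨ unimodalityInequation s t (`op s p) (`op t q) r
  cond⇔unimodalityInequation □₊ □₋ p q r =
    mk⇔ (λ c ρ → c (ρ 0) (ρ 1)) (λ h a b → h (valuation a b b))
  cond⇔unimodalityInequation □₋ □₊ p q r =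
    mk⇔ (λ c ρ → c (ρ 0) (ρ 1)) (λ h a b → h (valuation a b b))
  cond⇔unimodalityInequation ◇₊ ◇₋ p q r =
    mk⇔ (λ c ρ → c (ρ 0) (ρ 1)) (λ h a b → h (valuation a b b))
  cond⇔unimodalityInequation ◇₋ ◇₊ p q r =
    mk⇔ (λ c ρ → c (ρ 0) (ρ 1)) (λ h a b → h (valuation a b b))
  cond⇔unimodalityInequation □₊ ◇₋ p q r =
    mk⇔ (λ c ρ → to quasiIdentity⇔⇒-inequation (c (ρ 0)))
        (λ h a → from quasiIdentity⇔⇒-inequation (h (valuation a a a)))
  cond⇔unimodalityInequation □₋ ◇₊ p q r =
    mk⇔ (λ c ρ → to quasiIdentity⇔⇒-inequation (c (ρ 0)))
        (λ h a → from quasiIdentity⇔⇒-inequation (h (valuation a a a)))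
  cond⇔unimodalityInequation ◇₊ □₋ p q r =
    mk⇔ (λ c ρ → to (quasiIdentity⇔−-inequation r (coHeyting r)) (c (ρ 0)))
        (λ h a → from (quasiIdentity⇔−-inequation r (coHeyting r)) (h (valuation a a a)))
  cond⇔unimodalityInequation ◇₋ □₊ p q r =
    mk⇔ (λ c ρ → to (quasiIdentity⇔−-inequation r (coHeyting r)) (c (ρ 0)))
        (λ h a → from (quasiIdentity⇔−-inequation r (coHeyting r)) (h (valuation a a a)))
  cond⇔unimodalityInequation □₊ ◇₊ p q r =
    mk⇔ (λ c ρ → to quasiIdentity⇔∧⇒-inequation (c (ρ 0) (ρ 1)))
        (λ h a b → from quasiIdentity⇔∧⇒-inequation (h (valuation a b b)))
  cond⇔unimodalityInequation □₋ ◇₋ p q r =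
    mk⇔ (λ c ρ → to quasiIdentity⇔∧⇒-inequation (c (ρ 0) (ρ 1)))
        (λ h a b → from quasiIdentity⇔∧⇒-inequation (h (valuation a b b)))
  cond⇔unimodalityInequation ◇₊ □₊ p q r =
    mk⇔ (λ c ρ → to (quasiIdentity⇔∨−-inequation r (coHeyting r)) (c (ρ 0) (ρ 1)))
        (λ h a b → from (quasiIdentity⇔∨−-inequation r (coHeyting r)) (h (valuation a b b)))
  cond⇔unimodalityInequation ◇₋ □₋ p q r =
    mk⇔ (λ c ρ → to (quasiIdentity⇔∨−-inequation r (coHeyting r)) (c (ρ 0) (ρ 1)))
        (λ h a b → from (quasiIdentity⇔∨−-inequation r (coHeyting r)) (h (valuation a b b)))
  cond⇔unimodalityInequation □₊ □₊ p q r = mk⇔ (λ _ _ → ≤-refl) (λ _ → tt)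
  cond⇔unimodalityInequation □₋ □₋ p q r = mk⇔ (λ _ _ → ≤-refl) (λ _ → tt)
  cond⇔unimodalityInequation ◇₊ ◇₊ p q r = mk⇔ (λ _ _ → ≤-refl) (λ _ → tt)
  cond⇔unimodalityInequation ◇₋ ◇₋ p q r = mk⇔ (λ _ _ → ≤-refl) (λ _ → tt)

axioms-sound : {bi : Bool} {L : Signature} (A : RawAlg bi L) → HeytingUnimodal bi L A →
               (s t : Term bi L) → Axiom s t → Satisfies A s t
axioms-sound A (U , heyting , coHeyting) _ _ axiom ρ = sound axiom
  where
  open RawAlg A
  open IsUnimodal U
  open IsBDL isBDL
  module D = LS.IsDistributiveLattice isDistributiveLattice
  open HeytingProperties A isBDL heyting
  open CoHeytingProperties A isBDL using (−-unit; −-counit; −-distribʳ-∨)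

  a b c : Carrier
  a = ρ 0
  b = ρ 1
  c = ρ 2

  sound : ∀ {s t} → Axiom s t → eval A ρ s ≡ eval A ρ t
  sound join-comm              = D.∨-comm a b
  sound join-assoc             = D.∨-assoc a b c
  sound meet-comm              = D.∧-comm a b
  sound meet-assoc             = D.∧-assoc a b c
  sound join-absorbs-meet      = D.∨-absorbs-∧ a b
  sound meet-absorbs-join      = D.∧-absorbs-∨ a b
  sound join-distribˡ-meet     = proj₁ D.∨-distrib-∧ a b c
  sound join-distribʳ-meet     = proj₂ D.∨-distrib-∧ a b c
  sound meet-distribˡ-join     = proj₁ D.∧-distrib-∨ a b c
  sound meet-distribʳ-join     = proj₂ D.∧-distrib-∨ a b c
  sound top-greatest           = top-max a
  sound bot-least              = bot-min a
  sound imp-elim               = ⇒-elim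
  sound imp-unit               = ⇒-unit
  sound imp-distribˡ-meet      = ⇒-distribˡ-∧
  sound (sub-unit p)           = −-unit p (coHeyting p)
  sound (sub-counit p)         = −-counit p (coHeyting p)
  sound (sub-distribʳ-join p)  = −-distribʳ-∨ p (coHeyting p)
  sound (□₊-meet p)            = proj₁ (modalLaws □₊ p) a b
  sound (□₊-top p)             = proj₂ (modalLaws □₊ p)
  sound (□₋-join p)            = proj₁ (modalLaws □₋ p) a b
  sound (□₋-bot p)             = proj₂ (modalLaws □₋ p)
  sound (◇₊-join p)            = proj₁ (modalLaws ◇₊ p) a b
  sound (◇₊-bot p)             = proj₂ (modalLaws ◇₊ p)
  sound (◇₋-meet p)            = proj₁ (modalLaws ◇₋ p) a b
  sound (◇₋-top p)             = proj₂ (modalLaws ◇₋ p)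
  sound (unimodality s t p q r) =
    to (cond⇔unimodalityInequation A isBDL heyting coHeyting s t p q r) (unimodal s t p q) ρ

AllEquational : Bool → Signature → Set
AllEquational bi L = (s t : Sym) → T (L s) → T (L t) → Equational bi s t

module Completeness {bi : Bool} {L : Signature} (equational : AllEquational bi L)
                    (A : RawAlg bi L) (sat : (s t : Term bi L) → Axiom s t → Satisfies A s t)
                    where
  open RawAlg A

  holds : ∀ {s t} → Axiom s t → (a b c : Carrier) →
          eval A (valuation a b c) s ≡ eval A (valuation a b c) t
  holds axiom a b c = sat _ _ axiom (valuation a b c)

  isBDL : IsBDL A
  isBDL = record
    { isDistributiveLattice = record
      { isLattice = record
        { isEquivalence = record { refl = refl ; sym = sym ; trans = trans }
        ; ∨-comm        = λ a b → holds join-comm a b a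
        ; ∨-assoc       = holds join-assoc
        ; ∨-cong        = cong₂ _∨_
        ; ∧-comm        = λ a b → holds meet-comm a b a
        ; ∧-assoc       = holds meet-assoc
        ; ∧-cong        = cong₂ _∧_
        ; absorptive    = (λ a b → holds join-absorbs-meet a b a)
                        , (λ a b → holds meet-absorbs-join a b a)
        }
      ; ∨-distrib-∧ = holds join-distribˡ-meet , holds join-distribʳ-meet
      ; ∧-distrib-∨ = holds meet-distribˡ-join , holds meet-distribʳ-join
      }
    ; top-max = λ a → holds top-greatest a a a
    ; bot-min = λ a → holds bot-least a a a
    }

  open LatticeOrder A isBDL

  ⇒-monoʳ-≤ : ∀ {a b c} → b ≤ c → (a ⇒ b) ≤ (a ⇒ c)
  ⇒-monoʳ-≤ {a} {b} {c} b≤c = ≤-trans (≤-reflexive a⇒b≡[a⇒b]∧[a⇒c]) x∧y≤y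
    where
    a⇒b≡[a⇒b]∧[a⇒c] : (a ⇒ b) ≡ ((a ⇒ b) ∧ (a ⇒ c))
    a⇒b≡[a⇒b]∧[a⇒c] = trans (cong (a ⇒_) (sym b≤c)) (holds imp-distribˡ-meet a b c)

  heyting : IsHeytingImp A
  heyting a b c = mk⇔
    (λ a∧b≤c → ≤-trans (holds imp-unit a b b) (⇒-monoʳ-≤ a∧b≤c))
    (λ b≤a⇒c → ≤-trans (∧-monoʳ-≤ b≤a⇒c) (holds imp-elim a c c))

  module _ (p : T bi) where
    −-monoˡ-≤ : ∀ {a b c} → a ≤ b → sub p a c ≤ sub p b c
    −-monoˡ-≤ {a} {b} {c} a≤b = ≤-trans x≤x∨y (≤-reflexive [a−c]∨[b−c]≡b−c)
      where
      [a−c]∨[b−c]≡b−c : (sub p a c ∨ sub p b c) ≡ sub p b c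
      [a−c]∨[b−c]≡b−c =
        trans (sym (holds (sub-distribʳ-join p) a b c)) (cong (λ u → sub p u c) (x≤y⇒x∨y≡y a≤b))

    coHeyting : IsCoHeytingSub A p
    coHeyting a b c = mk⇔
      (λ a≤b∨c → ≤-trans (−-monoˡ-≤ a≤b∨c) (holds (sub-counit p) b c c))
      (λ a−b≤c → ≤-trans (holds (sub-unit p) a b b) (∨-monoʳ-≤ a−b≤c))

  modalLaws : (m : Sym) (p : T (L m)) → ModalLaws A m (op m p)
  modalLaws □₊ p = (λ a b → holds (□₊-meet p) a b a) , holds (□₊-top p) top top top
  modalLaws □₋ p = (λ a b → holds (□₋-join p) a b a) , holds (□₋-bot p) top top top
  modalLaws ◇₊ p = (λ a b → holds (◇₊-join p) a b a) , holds (◇₊-bot p) top top top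
  modalLaws ◇₋ p = (λ a b → holds (◇₋-meet p) a b a) , holds (◇₋-top p) top top top

  unimodal : (s t : Sym) (p : T (L s)) (q : T (L t)) → Cond A s t (op s p) (op t q)
  unimodal s t p q =
    from (cond⇔unimodalityInequation A isBDL heyting coHeyting s t p q r)
         (sat _ _ (unimodality s t p q r))
    where
    r : Equational bi s t
    r = equational s t p q

  isHeytingUnimodal : HeytingUnimodal bi L A
  isHeytingUnimodal =
    record { isBDL = isBDL ; modalLaws = modalLaws ; unimodal = unimodal } , heyting , coHeyting

heytingUnimodal-isVariety : {bi : Bool} {L : Signature} → AllEquational bi L →
                            IsVariety (HeytingUnimodal bi L)
heytingUnimodal-isVariety equational =
  Axiom , λ A → mk⇔ (axioms-sound A) (Completeness.isHeytingUnimodal equational A)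

isVariety-resp-⇔ : {bi : Bool} {L : Signature} {K K′ : RawAlg bi L → Set} →
                   ((A : RawAlg bi L) → K A ⇔ K′ A) → IsVariety K → IsVariety K′
isVariety-resp-⇔ K⇔K′ (E , K⇔E) = E , λ A → ⇔-trans (⇔-sym (K⇔K′ A)) (K⇔E A)

biHeytingUnimodal⇔ : (L : Signature) (A : RawAlg true L) →
                     HeytingUnimodal true L A ⇔ IsBiHeytingUnimodal L A
biHeytingUnimodal⇔ L A =
  mk⇔ (λ (U , H , S) → U , H , S tt) (λ (U , H , S) → U , H , λ _ → S)

heytingUnimodal⇔ : (L : Signature) (A : RawAlg false L) →
                   HeytingUnimodal false L A ⇔ IsHeytingUnimodal L A
heytingUnimodal⇔ L A = mk⇔ (λ (U , H , _) → U , H) (λ (U , H) → U , H , λ ())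

boxPair-isDiamond : (L : Signature) → IsBoxPair L → (s : Sym) → T (L s) → isDiamond s ≡ false
boxPair-isDiamond L _                  □₊ _ = refl
boxPair-isDiamond L _                  □₋ _ = refl
boxPair-isDiamond L (_ , _ , ◇₊∉L , _) ◇₊ p = ⊥-elim (subst T ◇₊∉L p)
boxPair-isDiamond L (_ , _ , _ , ◇₋∉L) ◇₋ p = ⊥-elim (subst T ◇₋∉L p)

diamondPair-isDiamond : (L : Signature) → IsDiamondPair L → (t : Sym) → T (L t) → isDiamond t ≡ true
diamondPair-isDiamond L (□₊∉L , _ , _ , _) □₊ q = ⊥-elim (subst T □₊∉L q)
diamondPair-isDiamond L (_ , □₋∉L , _ , _) □₋ q = ⊥-elim (subst T □₋∉L q)
diamondPair-isDiamond L _                  ◇₊ _ = refl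
diamondPair-isDiamond L _                  ◇₋ _ = refl

noDiamondBox : (L : Signature) → IsBoxPair L ⊎ IsDiamondPair L ⊎ IsSingleton L →
               (s t : Sym) → T (L s) → T (L t) → isDiamondBox s t ≡ false
noDiamondBox L (inj₁ boxPair) s t p q rewrite boxPair-isDiamond L boxPair s p = refl
noDiamondBox L (inj₂ (inj₁ diamondPair)) s t p q
  rewrite diamondPair-isDiamond L diamondPair t q = ∧-zeroʳ (isDiamond s)
noDiamondBox L (inj₂ (inj₂ (u , _ , onlyU))) s t p q
  rewrite onlyU s (to T-≡ p) | onlyU t (to T-≡ q) = ∧-inverseʳ (isDiamond u)

mainTheorem1 : (L : Signature) →
    IsVariety (IsBiHeytingUnimodal L)
    × (IsBoxPair L ⊎ IsDiamondPair L ⊎ IsSingleton L →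
       IsVariety (IsHeytingUnimodal L))
mainTheorem1 L =
    isVariety-resp-⇔ (biHeytingUnimodal⇔ L) (heytingUnimodal-isVariety λ s t _ _ → equational-bi s t)
  , λ signature → isVariety-resp-⇔ (heytingUnimodal⇔ L)
      (heytingUnimodal-isVariety λ s t p q →
        equational-¬diamondBox s t (noDiamondBox L signature s t p q))
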